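{- Let $G$ and $H$ be connected graphs. Then $v_s(G)\,v_s(H) \le \gamma_P(G \Box H)$. In addition, if $\gamma_P(G) = v_s(G)$ and $\gamma_P(H) = v_s(H)$, then $\gamma_P(G)\gamma_P(H) \le \gamma_P(G \Box H)$.
   Context: Graphs are finite and simple. A leaf is a vertex of degree $1$; a strong support vertex is a vertex adjacent to at least two leaves; $v_s(G)$ denotes the number of strong support vertices of $G$. For $S \subseteq V(G)$, vertices are observed as follows: initially every vertex of $S$ and every neighbor of a vertex of $S$ is observed; then, repeatedly, whenever an observed vertex has exactly one unobserved neighbor, that neighbor becomes observed. $S$ is a power dominating set if eventually all vertices are observed; $\gamma_P(G)$ is the minimum size of a power dominating set. The Cartesian product $G \Box H$ has vertex set $V(G)\times V(H)$, with $(g_1,h_1)$ adjacent to $(g_2,h_2)$ iff either $g_1=g_2$ and $h_1h_2 \in E(H)$, or $h_1=h_2$ and $g_1g_2\in E(G)$. -}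

module Defs where

open import Data.Nat using (ℕ; zero; suc; _+_; _*_; _≤_)
open import Data.Bool using (Bool; true; false; if_then_else_; _∧_; _∨_)
open import Data.Fin using (Fin; zero; suc; remQuot; _≟_)
open import Data.Fin.Subset using (Subset; _∈_; ∣_∣)
open import Data.Product using (Σ; _×_; _,_; proj₁; proj₂)
open import Relation.Nullary using (¬_)
open import Relation.Nullary.Decidable using (⌊_⌋)
open import Relation.Binary.PropositionalEquality using (_≡_)

record Graph : Set where
  field
    n   : ℕ
    adj : Fin n → Fin n → Bool
open Graph public

record IsSimple (G : Graph) : Set where
  field
    symm   : ∀ u v → adj G u v ≡ adj G v u
    irrefl : ∀ v → adj G v v ≡ false

countᵇ : (k : ℕ) → (Fin k → Bool) → ℕ
countᵇ zero    f = 0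
countᵇ (suc k) f = (if f zero then 1 else 0) + countᵇ k (λ i → f (suc i))

degree : (G : Graph) → Fin (n G) → ℕ
degree G v = countᵇ (n G) (adj G v)

isLeaf : (G : Graph) → Fin (n G) → Bool
isLeaf G v = ⌊ degree G v Data.Nat.≟ 1 ⌋

isStrongSupport : (G : Graph) → Fin (n G) → Bool
isStrongSupport G v = ⌊ 2 Data.Nat.≤? countᵇ (n G) (λ w → adj G v w ∧ isLeaf G w) ⌋

vs : Graph → ℕ
vs G = countᵇ (n G) (isStrongSupport G)

data Reach (G : Graph) (u : Fin (n G)) : Fin (n G) → Set where
  here : Reach G u u
  step : ∀ {v w} → Reach G u v → adj G v w ≡ true → Reach G u w

Connected : Graph → Set
Connected G = ∀ u v → Reach G u v

data Observed (G : Graph) (S : Subset (n G)) : Fin (n G) → Set where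
  inS   : ∀ {v} → v ∈ S → Observed G S v
  nbr   : ∀ {u v} → u ∈ S → adj G u v ≡ true → Observed G S v
  force : ∀ {u v} → Observed G S u → adj G u v ≡ true →
          (∀ w → adj G u w ≡ true → ¬ (w ≡ v) → Observed G S w) →
          Observed G S v

IsPowerDominating : (G : Graph) → Subset (n G) → Set
IsPowerDominating G S = ∀ v → Observed G S v

IsPowerDomNumber : Graph → ℕ → Set
IsPowerDomNumber G k =
  Σ (Subset (n G)) (λ S → IsPowerDominating G S × ∣ S ∣ ≡ k)
  × (∀ S → IsPowerDominating G S → k ≤ ∣ S ∣)

_□_ : Graph → Graph → Graph
G □ H = record { n = n G * n H ; adj = a }
  where
  a : Fin (n G * n H) → Fin (n G * n H) → Bool
  a x y with remQuot (n H) x | remQuot (n H) y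
  ... | g₁ , h₁ | g₂ , h₂ =
    (⌊ g₁ ≟ g₂ ⌋ ∧ adj H h₁ h₂) ∨ (⌊ h₁ ≟ h₂ ⌋ ∧ adj G g₁ g₂)

-- Let s and t be strong support vertices of G and H, with leaves ℓ₁ ≠ ℓ₂ at s and m₁ ≠ m₂ at t,
-- and call s together with its leaves the star of s. The only neighbours of a corner (ℓᵢ , mⱼ)
-- of G □ H are (ℓᵢ , t) and (s , mⱼ), and each of them is adjacent to two corners. So if S has no
-- vertex in star(s) × star(t), no corner is dominated by S, and no corner is ever forced, because
-- a forcing vertex would have a second, still unobserved, corner as neighbour. Hence every power
-- dominating set meets every star(s) × star(t); stars of distinct strong support vertices are
-- disjoint, which yields vs G · vs H distinct vertices of S.
module Submission where

open import Defs
open import Data.Nat using (ℕ; suc; _*_; _≤_; z≤n; s≤s)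
open import Data.Nat.Properties using (m≤n+m; ≤-trans)
open import Data.Bool using (Bool; true; false; not; _∧_; _∨_)
open import Data.Bool.Properties using (∨-zeroʳ)
open import Data.Fin using (Fin; zero; suc; toℕ; fromℕ<; remQuot; combine; _≟_)
open import Data.Fin.Properties
  using (any?; suc-injective; toℕ-fromℕ<; injective⇒≤; remQuot-combine; combine-remQuot;
         combine-injective)
open import Data.Fin.Subset using (Subset; _∈_; ∣_∣; inside; outside)
open import Data.Fin.Subset.Properties using (_∈?_)
open import Data.Vec using (_∷_; here; there)
open import Data.Product using (_×_; ∃; ∃₂; _,_; proj₁; proj₂; uncurry; map; map₁)
open import Data.Sum using (_⊎_; inj₁; inj₂)
open import Data.Empty using (⊥-elim)
open import Function using (_∘_)
open import Function.Definitions using (Injective)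
open import Relation.Nullary using (¬_; Dec; yes; no; contradiction)
open import Relation.Nullary.Decidable using (⌊_⌋; _×-dec_; _⊎-dec_)
open import Relation.Binary.PropositionalEquality using (_≡_; _≢_; refl; sym; trans; cong; cong₂; subst)

⌊⌋≡true⇒witness : ∀ {P : Set} (d : Dec P) → ⌊ d ⌋ ≡ true → P
⌊⌋≡true⇒witness (yes p) _ = p

witness⇒⌊⌋≡true : ∀ {P : Set} (d : Dec P) → P → ⌊ d ⌋ ≡ true
witness⇒⌊⌋≡true (yes _) _ = refl
witness⇒⌊⌋≡true (no ¬p) p = contradiction p ¬p

∧-true⁻ : ∀ {x y} → (x ∧ y) ≡ true → x ≡ true × y ≡ true
∧-true⁻ {true} y≡true = refl , y≡true

∨-true⁻ : ∀ {x y} → (x ∨ y) ≡ true → x ≡ true ⊎ y ≡ true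
∨-true⁻ {true}  _       = inj₁ refl
∨-true⁻ {false} y≡true = inj₂ y≡true

countᵇ-tail≤ : ∀ {k} (f : Fin (suc k) → Bool) → countᵇ k (f ∘ suc) ≤ countᵇ (suc k) f
countᵇ-tail≤ {k} f = m≤n+m (countᵇ k (f ∘ suc)) _

true⇒1≤countᵇ : ∀ {k} (f : Fin k → Bool) {a} → f a ≡ true → 1 ≤ countᵇ k f
true⇒1≤countᵇ f {zero}  fa rewrite fa = s≤s z≤n
true⇒1≤countᵇ f {suc a} fa = ≤-trans (true⇒1≤countᵇ (f ∘ suc) fa) (countᵇ-tail≤ f)

distinct-true⇒2≤countᵇ : ∀ {k} (f : Fin k → Bool) {a b} → a ≢ b →
                         f a ≡ true → f b ≡ true → 2 ≤ countᵇ k f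
distinct-true⇒2≤countᵇ f {zero}  {zero}  a≢b _  _  = contradiction refl a≢b
distinct-true⇒2≤countᵇ f {zero}  {suc b} _   fa fb rewrite fa = s≤s (true⇒1≤countᵇ (f ∘ suc) fb)
distinct-true⇒2≤countᵇ f {suc a} {zero}  _   fa fb rewrite fb = s≤s (true⇒1≤countᵇ (f ∘ suc) fa)
distinct-true⇒2≤countᵇ f {suc a} {suc b} a≢b fa fb =
  ≤-trans (distinct-true⇒2≤countᵇ (f ∘ suc) (a≢b ∘ cong suc) fa fb) (countᵇ-tail≤ f)

enumerate : ∀ {k} (f : Fin k → Bool) → Fin (countᵇ k f) → Fin k
enumerate {suc k} f i with f zero
enumerate {suc k} f zero    | true  = zero
enumerate {suc k} f (suc i) | true  = suc (enumerate (f ∘ suc) i)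
enumerate {suc k} f i       | false = suc (enumerate (f ∘ suc) i)

enumerate-true : ∀ {k} (f : Fin k → Bool) i → f (enumerate f i) ≡ true
enumerate-true {suc k} f i with f zero in f0
enumerate-true {suc k} f zero    | true  = f0
enumerate-true {suc k} f (suc i) | true  = enumerate-true (f ∘ suc) i
enumerate-true {suc k} f i       | false = enumerate-true (f ∘ suc) i

enumerate-injective : ∀ {k} (f : Fin k → Bool) → Injective _≡_ _≡_ (enumerate f)
enumerate-injective {suc k} f {i} {j} eq with f zero
enumerate-injective {suc k} f {zero}  {zero}  eq | true = refl
enumerate-injective {suc k} f {suc i} {suc j} eq | true =
  cong suc (enumerate-injective (f ∘ suc) (suc-injective eq))
enumerate-injective {suc k} f {i}     {j}     eq | false =
  enumerate-injective (f ∘ suc) (suc-injective eq)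

2≤countᵇ⇒distinct-true : ∀ {k} (f : Fin k → Bool) → 2 ≤ countᵇ k f →
                         ∃₂ λ a b → a ≢ b × f a ≡ true × f b ≡ true
2≤countᵇ⇒distinct-true f 2≤c =
  enumerate f i₀ , enumerate f i₁ , i₀≢i₁ ∘ enumerate-injective f ,
  enumerate-true f i₀ , enumerate-true f i₁
  where
  i₀ i₁ : Fin _
  i₀ = fromℕ< (≤-trans (s≤s z≤n) 2≤c)
  i₁ = fromℕ< 2≤c
  i₀≢i₁ : i₀ ≢ i₁
  i₀≢i₁ eq with () ← trans (sym (toℕ-fromℕ< _)) (trans (cong toℕ eq) (toℕ-fromℕ< 2≤c))

rank : ∀ {k} (S : Subset k) {x} → x ∈ S → Fin ∣ S ∣
rank (inside  ∷ S) here      = zero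
rank (inside  ∷ S) (there p) = suc (rank S p)
rank (outside ∷ S) (there p) = rank S p

rank-injective : ∀ {k} (S : Subset k) {x y} (p : x ∈ S) (q : y ∈ S) → rank S p ≡ rank S q → x ≡ y
rank-injective (inside  ∷ S) here      here      _  = refl
rank-injective (inside  ∷ S) (there p) (there q) eq =
  cong suc (rank-injective S p q (suc-injective eq))
rank-injective (outside ∷ S) (there p) (there q) eq = cong suc (rank-injective S p q eq)

injection-into⇒≤∣∣ : ∀ {m k} (S : Subset k) (f : Fin m → Fin k) →
                     (∀ i → f i ∈ S) → Injective _≡_ _≡_ f → m ≤ ∣ S ∣
injection-into⇒≤∣∣ S f f∈S f-inj =
  injective⇒≤ (λ {i} {j} eq → f-inj (rank-injective S (f∈S i) (f∈S j) eq))

remQuot-injective : ∀ {m} k → Injective _≡_ _≡_ (remQuot {m} k)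
remQuot-injective {m} k {i} {j} eq =
  trans (sym (combine-remQuot {m} k i))
        (trans (cong (uncurry combine) eq) (combine-remQuot {m} k j))

Star : (G : Graph) → Fin (n G) → Fin (n G) → Set
Star G s g = g ≡ s ⊎ (adj G s g ≡ true × isLeaf G g ≡ true)

star? : (G : Graph) → ∀ s g → Dec (Star G s g)
star? G s g = (g ≟ s) ⊎-dec ((adj G s g Data.Bool.≟ true) ×-dec (isLeaf G g Data.Bool.≟ true))

record PendantPair (G : Graph) (s : Fin (n G)) : Set where
  field
    leaf          : Bool → Fin (n G)
    leaf-distinct : ∀ i → leaf i ≢ leaf (not i)
    adj-leaf      : ∀ i → adj G s (leaf i) ≡ true
    leaf-isLeaf   : ∀ i → isLeaf G (leaf i) ≡ true

pendantNeighbour : (G : Graph) → Fin (n G) → Fin (n G) → Bool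
pendantNeighbour G s w = adj G s w ∧ isLeaf G w

strong⇒pendantPair : ∀ (G : Graph) {s} → isStrongSupport G s ≡ true → PendantPair G s
strong⇒pendantPair G {s} strong
  with a , b , a≢b , a-pendant , b-pendant
       ← 2≤countᵇ⇒distinct-true (pendantNeighbour G s)
           (⌊⌋≡true⇒witness (2 Data.Nat.≤? countᵇ (n G) (pendantNeighbour G s)) strong)
  = record
  { leaf          = λ { true → a ; false → b }
  ; leaf-distinct = λ { true → a≢b ; false → a≢b ∘ sym }
  ; adj-leaf      = λ { true → proj₁ (∧-true⁻ a-pendant) ; false → proj₁ (∧-true⁻ b-pendant) }
  ; leaf-isLeaf   = λ { true → proj₂ (∧-true⁻ a-pendant) ; false → proj₂ (∧-true⁻ b-pendant) }
  }

leaf⇒degree≡1 : ∀ (G : Graph) {l} → isLeaf G l ≡ true → degree G l ≡ 1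
leaf⇒degree≡1 G {l} = ⌊⌋≡true⇒witness (degree G l Data.Nat.≟ 1)

strong⇒2≤degree : ∀ (G : Graph) {s} → isStrongSupport G s ≡ true → 2 ≤ degree G s
strong⇒2≤degree G {s} strong =
  distinct-true⇒2≤countᵇ (adj G s) (leaf-distinct true) (adj-leaf true) (adj-leaf false)
  where open PendantPair (strong⇒pendantPair G strong)

module _ {G : Graph} (simple : IsSimple G) where
  open IsSimple simple

  adj-sym : ∀ {u v} → adj G u v ≡ true → adj G v u ≡ true
  adj-sym {u} {v} e = trans (symm v u) e

  leaf-neighbours-equal : ∀ {l u v} → isLeaf G l ≡ true →
                          adj G l u ≡ true → adj G l v ≡ true → u ≡ v
  leaf-neighbours-equal {l} {u} {v} leaf lu lv with u ≟ v
  ... | yes u≡v = u≡v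
  ... | no  u≢v with s≤s () ← subst (2 ≤_) (leaf⇒degree≡1 G leaf)
                                     (distinct-true⇒2≤countᵇ (adj G l) u≢v lu lv)

  strong-not-leaf : ∀ {s} → isStrongSupport G s ≡ true → isLeaf G s ≢ true
  strong-not-leaf {s} strong leaf
    with s≤s () ← subst (2 ≤_) (leaf⇒degree≡1 G leaf) (strong⇒2≤degree G strong)

  stars-disjoint : ∀ {s s' g} → isStrongSupport G s ≡ true → isStrongSupport G s' ≡ true →
                   Star G s g → Star G s' g → s ≡ s'
  stars-disjoint _ _ (inj₁ g≡s) (inj₁ g≡s') = trans (sym g≡s) g≡s'
  stars-disjoint strong _ (inj₁ refl) (inj₂ (_ , leaf)) = contradiction leaf (strong-not-leaf strong)
  stars-disjoint _ strong' (inj₂ (_ , leaf)) (inj₁ refl) = contradiction leaf (strong-not-leaf strong')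
  stars-disjoint _ _ (inj₂ (sg , leaf)) (inj₂ (s'g , _)) =
    leaf-neighbours-equal leaf (adj-sym sg) (adj-sym s'g)

module □-Coordinates (G H : Graph) where
  π₁ : Fin (n (G □ H)) → Fin (n G)
  π₁ x = proj₁ (remQuot {n G} (n H) x)

  π₂ : Fin (n (G □ H)) → Fin (n H)
  π₂ x = proj₂ (remQuot {n G} (n H) x)

  π₁-combine : ∀ (g : Fin (n G)) (h : Fin (n H)) → π₁ (combine g h) ≡ g
  π₁-combine g h = cong proj₁ (remQuot-combine g h)

  π₂-combine : ∀ (g : Fin (n G)) (h : Fin (n H)) → π₂ (combine g h) ≡ h
  π₂-combine g h = cong proj₂ (remQuot-combine g h)

  Stars : Fin (n G) → Fin (n H) → Fin (n (G □ H)) → Set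
  Stars s t x = Star G s (π₁ x) × Star H t (π₂ x)

  adj-□ : ∀ x y → adj (G □ H) x y ≡
          ((⌊ π₁ x ≟ π₁ y ⌋ ∧ adj H (π₂ x) (π₂ y)) ∨ (⌊ π₂ x ≟ π₂ y ⌋ ∧ adj G (π₁ x) (π₁ y)))
  adj-□ x y with remQuot {n G} (n H) x | remQuot {n G} (n H) y
  ... | _ | _ = refl

  adj-□-combine : ∀ u (g : Fin (n G)) (h : Fin (n H)) → adj (G □ H) u (combine g h) ≡
                  ((⌊ π₁ u ≟ g ⌋ ∧ adj H (π₂ u) h) ∨ (⌊ π₂ u ≟ h ⌋ ∧ adj G (π₁ u) g))
  adj-□-combine u g h =
    trans (adj-□ u (combine g h))
          (cong₂ (λ g' h' → (⌊ π₁ u ≟ g' ⌋ ∧ adj H (π₂ u) h') ∨ (⌊ π₂ u ≟ h' ⌋ ∧ adj G (π₁ u) g'))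
                 (π₁-combine g h) (π₂-combine g h))

  □-adj-vertical : ∀ {u} {g : Fin (n G)} {h : Fin (n H)} →
                   π₁ u ≡ g → adj H (π₂ u) h ≡ true → adj (G □ H) u (combine g h) ≡ true
  □-adj-vertical {u} {g} {h} u₁≡g adj-h
    rewrite adj-□-combine u g h | witness⇒⌊⌋≡true (π₁ u ≟ g) u₁≡g | adj-h = refl

  □-adj-horizontal : ∀ {u} {g : Fin (n G)} {h : Fin (n H)} →
                     π₂ u ≡ h → adj G (π₁ u) g ≡ true → adj (G □ H) u (combine g h) ≡ true
  □-adj-horizontal {u} {g} {h} u₂≡h adj-g
    rewrite adj-□-combine u g h | witness⇒⌊⌋≡true (π₂ u ≟ h) u₂≡h | adj-g = ∨-zeroʳ _

  □-adj-combine⁻ : ∀ {u} {g : Fin (n G)} {h : Fin (n H)} → adj (G □ H) u (combine g h) ≡ true →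
                   (π₁ u ≡ g × adj H (π₂ u) h ≡ true) ⊎ (π₂ u ≡ h × adj G (π₁ u) g ≡ true)
  □-adj-combine⁻ {u} {g} {h} uv with ∨-true⁻ (trans (sym (adj-□-combine u g h)) uv)
  ... | inj₁ vertical   = inj₁ (map₁ (⌊⌋≡true⇒witness (π₁ u ≟ g)) (∧-true⁻ vertical))
  ... | inj₂ horizontal = inj₂ (map₁ (⌊⌋≡true⇒witness (π₂ u ≟ h)) (∧-true⁻ horizontal))

module LeafSquare {G H : Graph} (simpleG : IsSimple G) (simpleH : IsSimple H)
                  {s t} (PG : PendantPair G s) (PH : PendantPair H t) where
  open □-Coordinates G H
  open PendantPair PG
    renaming (leaf to ℓ; leaf-distinct to ℓ-distinct; adj-leaf to adj-ℓ; leaf-isLeaf to ℓ-isLeaf)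
  open PendantPair PH
    renaming (leaf to m; leaf-distinct to m-distinct; adj-leaf to adj-m; leaf-isLeaf to m-isLeaf)

  corner : Bool → Bool → Fin (n (G □ H))
  corner i j = combine (ℓ i) (m j)

  IsCorner : Fin (n (G □ H)) → Set
  IsCorner v = ∃₂ λ i j → v ≡ corner i j

  ℓ-in-star : ∀ {g} i → g ≡ ℓ i → Star G s g
  ℓ-in-star i refl = inj₂ (adj-ℓ i , ℓ-isLeaf i)

  m-in-star : ∀ {h} j → h ≡ m j → Star H t h
  m-in-star j refl = inj₂ (adj-m j , m-isLeaf j)

  corner-in-stars : ∀ i j → Stars s t (corner i j)
  corner-in-stars i j = ℓ-in-star i (π₁-combine (ℓ i) (m j)) , m-in-star j (π₂-combine (ℓ i) (m j))

  corner-neighbour : ∀ {u i j} → adj (G □ H) u (corner i j) ≡ true →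
                     (π₁ u ≡ ℓ i × π₂ u ≡ t) ⊎ (π₁ u ≡ s × π₂ u ≡ m j)
  corner-neighbour {u} {i} {j} uv with □-adj-combine⁻ uv
  ... | inj₁ (u₁≡ℓ , adj-u₂) =
    inj₁ (u₁≡ℓ , leaf-neighbours-equal simpleH (m-isLeaf j)
                   (adj-sym simpleH adj-u₂) (adj-sym simpleH (adj-m j)))
  ... | inj₂ (u₂≡m , adj-u₁) =
    inj₂ (leaf-neighbours-equal simpleG (ℓ-isLeaf i)
            (adj-sym simpleG adj-u₁) (adj-sym simpleG (adj-ℓ i)) , u₂≡m)

  corner-neighbour-in-stars : ∀ {u i j} → adj (G □ H) u (corner i j) ≡ true → Stars s t u
  corner-neighbour-in-stars {i = i} {j} uv with corner-neighbour uv
  ... | inj₁ (u₁≡ℓ , u₂≡t) = ℓ-in-star i u₁≡ℓ , inj₁ u₂≡t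
  ... | inj₂ (u₁≡s , u₂≡m) = inj₁ u₁≡s , m-in-star j u₂≡m

  other-corner-neighbour : ∀ {u i j} → adj (G □ H) u (corner i j) ≡ true →
                           ∃₂ λ i' j' → corner i' j' ≢ corner i j
                                      × adj (G □ H) u (corner i' j') ≡ true
  other-corner-neighbour {u} {i} {j} uv with corner-neighbour uv
  ... | inj₁ (u₁≡ℓ , u₂≡t) =
    i , not j , m-distinct j ∘ sym ∘ proj₂ ∘ combine-injective (ℓ i) (m (not j)) (ℓ i) (m j) ,
    □-adj-vertical u₁≡ℓ (subst (λ h → adj H h (m (not j)) ≡ true) (sym u₂≡t) (adj-m (not j)))
  ... | inj₂ (u₁≡s , u₂≡m) =
    not i , j , ℓ-distinct i ∘ sym ∘ proj₁ ∘ combine-injective (ℓ (not i)) (m j) (ℓ i) (m j) ,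
    □-adj-horizontal u₂≡m (subst (λ g → adj G g (ℓ (not i)) ≡ true) (sym u₁≡s) (adj-ℓ (not i)))

  corners-unobserved : ∀ (S : Subset (n (G □ H))) → (∀ {x} → x ∈ S → ¬ Stars s t x) →
                       ∀ {v} → Observed (G □ H) S v → ¬ IsCorner v
  corners-unobserved S avoids (inS v∈S)     (i , j , refl) = avoids v∈S (corner-in-stars i j)
  corners-unobserved S avoids (nbr u∈S uv)  (i , j , refl) =
    avoids u∈S (corner-neighbour-in-stars uv)
  corners-unobserved S avoids (force _ uv observed-others) (i , j , refl)
    with i' , j' , other≢ , u-other ← other-corner-neighbour uv
    = corners-unobserved S avoids (observed-others _ u-other other≢) (i' , j' , refl)

module _ {G H : Graph} (simpleG : IsSimple G) (simpleH : IsSimple H)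
         {S : Subset (n (G □ H))} (dominating : IsPowerDominating (G □ H) S) where
  open □-Coordinates G H

  power-dominating-meets-stars : ∀ {s t} → isStrongSupport G s ≡ true → isStrongSupport H t ≡ true →
                                 ∃ λ x → x ∈ S × Stars s t x
  power-dominating-meets-stars {s} {t} strong-s strong-t
    with any? (λ x → (x ∈? S) ×-dec (star? G s (π₁ x) ×-dec star? H t (π₂ x)))
  ... | yes found = found
  ... | no  none  = ⊥-elim (corners-unobserved S (λ x∈S x-in-stars → none (_ , x∈S , x-in-stars))
                                                (dominating (corner true true)) (true , true , refl))
    where
    open LeafSquare simpleG simpleH (strong⇒pendantPair G strong-s) (strong⇒pendantPair H strong-t)

  strong-pair : Fin (vs G * vs H) → Fin (n G) × Fin (n H)
  strong-pair =
    map (enumerate (isStrongSupport G)) (enumerate (isStrongSupport H)) ∘ remQuot {vs G} (vs H)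

  strong-pair-strong : ∀ p → isStrongSupport G (proj₁ (strong-pair p)) ≡ true
                           × isStrongSupport H (proj₂ (strong-pair p)) ≡ true
  strong-pair-strong p = enumerate-true (isStrongSupport G) _ , enumerate-true (isStrongSupport H) _

  strong-pair-injective : Injective _≡_ _≡_ strong-pair
  strong-pair-injective pairs≡ = remQuot-injective {vs G} (vs H) (cong₂ _,_
    (enumerate-injective (isStrongSupport G) (cong proj₁ pairs≡))
    (enumerate-injective (isStrongSupport H) (cong proj₂ pairs≡)))

  meets-strong-pair : ∀ p → ∃ λ x → x ∈ S × uncurry Stars (strong-pair p) x
  meets-strong-pair p = uncurry power-dominating-meets-stars (strong-pair-strong p)

  representative : Fin (vs G * vs H) → Fin (n (G □ H))
  representative = proj₁ ∘ meets-strong-pair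

  representative-injective : Injective _≡_ _≡_ representative
  representative-injective {p} {q} rp≡rq = strong-pair-injective (cong₂ _,_
    (stars-disjoint simpleG (proj₁ (strong-pair-strong p)) (proj₁ (strong-pair-strong q))
                            (proj₁ p-stars) (proj₁ q-stars))
    (stars-disjoint simpleH (proj₂ (strong-pair-strong p)) (proj₂ (strong-pair-strong q))
                            (proj₂ p-stars) (proj₂ q-stars)))
    where
    p-stars : uncurry Stars (strong-pair p) (representative p)
    p-stars = proj₂ (proj₂ (meets-strong-pair p))
    q-stars : uncurry Stars (strong-pair q) (representative p)
    q-stars =
      subst (uncurry Stars (strong-pair q)) (sym rp≡rq) (proj₂ (proj₂ (meets-strong-pair q)))

  vs*vs≤∣power-dominating∣ : vs G * vs H ≤ ∣ S ∣
  vs*vs≤∣power-dominating∣ =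
    injection-into⇒≤∣∣ S representative (proj₁ ∘ proj₂ ∘ meets-strong-pair) representative-injective

lemma3p5 : (G H : Graph) → IsSimple G → IsSimple H → Connected G → Connected H →
           (a b c : ℕ) → IsPowerDomNumber G a → IsPowerDomNumber H b →
           IsPowerDomNumber (G □ H) c →
           (vs G * vs H ≤ c) × (a ≡ vs G → b ≡ vs H → a * b ≤ c)
lemma3p5 G H simpleG simpleH _ _ a b c _ _ ((S , dominating , ∣S∣≡c) , _) =
  vs*vs≤c , λ { refl refl → vs*vs≤c }
  where
  vs*vs≤c : vs G * vs H ≤ c
  vs*vs≤c = subst (vs G * vs H ≤_) ∣S∣≡c (vs*vs≤∣power-dominating∣ simpleG simpleH dominating)
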